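{- Let $\Pi$ be the problem in the context. For any two subsets $\mathcal{C},\mathcal{C}'\subseteq\mathfrak{C}$, we have $\ell(\mathcal{C})\le\ell(\mathcal{C}')$ (according to the hyperedge constraint of $\Pi$) if and only if $\mathcal{C}'\subseteq\mathcal{C}$.
   Context: Fix integers $\Delta\ge 2$, $r\ge 2$ and let $\mathfrak{C}=\{1,\dots,\Delta\}$. The problem $\Pi$ has label set $\{\ell(\mathcal{C}):\mathcal{C}\subseteq\mathfrak{C}\}$. Its hyperedge constraint $\mathcal{E}$ consists of all multisets $\ell(\mathcal{C}_1)\dots\ell(\mathcal{C}_r)$ of size $r$ such that for every color $i\in\mathfrak{C}$ there is at least one $j$ with $i\notin\mathcal{C}_j$. For labels $A,B$, we write $B\le A$ ($A$ is at least as strong as $B$ according to $\mathcal{E}$) if for every multiset in $\mathcal{E}$ containing $B$, replacing one occurrence of $B$ by $A$ yields a multiset in $\mathcal{E}$. -}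

module Defs where

open import Data.Nat using (ℕ)
open import Data.Fin using (Fin)
open import Data.Fin.Subset using (Subset; _∈_; _∉_; _⊆_)
open import Data.Vec using (Vec; lookup; _[_]≔_)
open import Data.Product using (∃)
open import Relation.Binary.PropositionalEquality using (_≡_)

data Label (Δ : ℕ) : Set where
  ℓ : Subset Δ → Label Δ

colours : ∀ {Δ} → Label Δ → Subset Δ
colours (ℓ C) = C

-- A multiset of r labels is represented by a vector of length r
-- (the constraint below is invariant under permuting the entries).
InE : ∀ {Δ r} → Vec (Label Δ) r → Set
InE {Δ} {r} v = (i : Fin Δ) → ∃ λ (j : Fin r) → i ∉ colours (lookup v j)

-- B ≤ A  (A at least as strong as B according to ℰ):
-- for every configuration in ℰ containing B (at position k), replacing
-- that occurrence of B by A yields a configuration in ℰ.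
_≤[_]_ : ∀ {Δ} → Label Δ → ℕ → Label Δ → Set
B ≤[ r ] A = (v : Vec (Label _) r) (k : Fin r) →
  lookup v k ≡ B → InE v → InE (v [ k ]≔ A)

-- Replacing an entry by a label with fewer colours can only help: every colour
-- still has a witness entry avoiding it, so ℓ 𝒞 ≤ ℓ 𝒞′ whenever 𝒞′ ⊆ 𝒞.
-- Conversely, if i ∈ 𝒞′ ∖ 𝒞, the configuration ℓ 𝒞, ℓ{i}, …, ℓ{i} lies in ℰ
-- (ℓ 𝒞 avoids i, ℓ{i} avoids every other colour), but after replacing ℓ 𝒞 by
-- ℓ 𝒞′ no entry avoids i.
module Submission where

open import Defs
open import Data.Nat using (ℕ; _≥_; suc; s≤s)
open import Data.Fin using (Fin; zero; suc)
open import Data.Fin.Properties using (_≟_)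
open import Data.Fin.Subset using (Subset; _⊆_; _∈_; _∉_; ⁅_⁆)
open import Data.Fin.Subset.Properties using (_∈?_; x∈⁅x⁆; x∈⁅y⁆⇒x≡y)
open import Data.Vec using (Vec; _∷_; replicate; lookup; _[_]≔_)
open import Data.Vec.Properties using (lookup∘update; lookup∘update′; lookup-replicate)
open import Data.Product using (_×_; _,_)
open import Data.Empty using (⊥-elim)
open import Relation.Nullary using (¬_; yes; no)
open import Relation.Binary.PropositionalEquality using (refl; sym; cong; subst)

module _ {Δ r : ℕ} (v : Vec (Label Δ) r) (k : Fin r) (A : Label Δ) where

  update-colours-⊆ : colours A ⊆ colours (lookup v k) →
    ∀ j → colours (lookup (v [ k ]≔ A) j) ⊆ colours (lookup v j)
  update-colours-⊆ A⊆ j with j ≟ k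
  ... | yes refl rewrite lookup∘update j v A = A⊆
  ... | no j≢k rewrite lookup∘update′ j≢k v A = λ i∈ → i∈

  InE-update-⊆ : colours A ⊆ colours (lookup v k) → InE v → InE (v [ k ]≔ A)
  InE-update-⊆ A⊆ inE i with inE i
  ... | j , i∉ = j , λ i∈ → i∉ (update-colours-⊆ A⊆ j i∈)

⊆⇒≤ : ∀ {Δ r} {C C′ : Subset Δ} → C′ ⊆ C → ℓ C ≤[ r ] ℓ C′
⊆⇒≤ C′⊆C v k eq =
  InE-update-⊆ v k _ (subst (_ ⊆_) (sym (cong colours eq)) C′⊆C)

module _ {Δ} (r : ℕ) (C : Subset Δ) (i : Fin Δ) where

  separating : Vec (Label Δ) (suc (suc r))
  separating = ℓ C ∷ replicate (suc r) (ℓ ⁅ i ⁆)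

  separating-InE : i ∉ C → InE separating
  separating-InE i∉C m with m ≟ i
  ... | yes refl = zero , i∉C
  ... | no m≢i = suc zero , λ m∈ → m≢i (x∈⁅y⁆⇒x≡y i m∈)

  separating-update-∉InE : ∀ {C′} → i ∈ C′ → ¬ InE (separating [ zero ]≔ ℓ C′)
  separating-update-∉InE i∈C′ inE with inE i
  ... | zero , i∉ = i∉ i∈C′
  ... | suc j , i∉ rewrite lookup-replicate j (ℓ ⁅ i ⁆) = i∉ (x∈⁅x⁆ i)

≤⇒⊇ : ∀ {Δ} r {C C′ : Subset Δ} → ℓ C ≤[ suc (suc r) ] ℓ C′ → C′ ⊆ C
≤⇒⊇ r {C} C≤C′ {i} i∈C′ with i ∈? C
... | yes i∈C = i∈C
... | no i∉C = ⊥-elim (separating-update-∉InE r C i i∈C′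
                 (C≤C′ (separating r C i) zero refl (separating-InE r C i i∉C)))

lemma15 : (Δ r : ℕ) → Δ ≥ 2 → r ≥ 2 → (C C′ : Subset Δ) →
    ((ℓ C ≤[ r ] ℓ C′) → C′ ⊆ C) × (C′ ⊆ C → ℓ C ≤[ r ] ℓ C′)
lemma15 Δ (suc (suc r)) _ (s≤s (s≤s _)) C C′ = ≤⇒⊇ r , ⊆⇒≤
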